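{- Let $S\subset \mathbb{Z}^n$ and suppose there is a realization $(T,W)$ of $S$ such that $T$ is a tree, with vertices of $T$ identified with their metric representations (so $V(T)=S$). Let $S_1=\{x\in S: (x_1-1,\dots,x_n-1)\in S\}$ and $S_0=S\setminus S_1$. Then $S_0$ is exactly the set of vertices of $T$ that lie on some path of $T$ both of whose end vertices belong to $W$ (a single vertex of $W$ counting as a trivial such path).
   Context: All graphs are finite, simple and connected. For a graph $G$ and an ordered vertex subset $W=\{\omega^1,\dots,\omega^n\}$, $r(u\mid W)=(d(u,\omega^1),\dots,d(u,\omega^n))$; $W$ is resolving if these vectors are pairwise distinct. A finite $S\subset\mathbb{Z}^n$ is realized by $(G,W)$ if $W$ is a resolving set of $G$ and $S=\{r(u\mid W):u\in V(G)\}$; each vertex $u$ is identified with the vector $r(u\mid W)\in S$. -}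

module Defs where

open import Data.Nat using (ℕ; zero; suc; _≤_; _+_)
open import Data.Fin using (Fin)
open import Data.List using (List; []; _∷_; length; [_])
open import Data.List.Membership.Propositional using (_∈_)
open import Data.List.Relation.Unary.Unique.Propositional using (Unique)
open import Data.Vec using (Vec; tabulate; map)
open import Data.Integer using (ℤ; +_; _-_; 1ℤ)
open import Data.Product using (Σ; ∃; _×_; _,_)
open import Relation.Nullary using (¬_)
open import Relation.Binary.PropositionalEquality using (_≡_)
open import Function.Definitions using (Injective)

record Graph (m : ℕ) : Set₁ where
  field
    Adj      : Fin m → Fin m → Set
    sym      : ∀ {u v} → Adj u v → Adj v u
    irrefl   : ∀ {u} → ¬ Adj u u
open Graph public

-- A walk given as a non-empty vertex sequence  v₀ ∷ vs  where consecutive vertices are adjacent.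
-- Chain G v vs : starting at v, the remaining vertices vs follow consecutively.
data Chain {m} (G : Graph m) : Fin m → List (Fin m) → Set where
  stop : ∀ {v} → Chain G v []
  step : ∀ {v w vs} → Adj G v w → Chain G w vs → Chain G v (w ∷ vs)

last : ∀ {A : Set} → A → List A → A
last a []       = a
last a (b ∷ bs) = last b bs

record Walk {m} (G : Graph m) (u v : Fin m) (k : ℕ) : Set where
  field
    rest  : List (Fin m)
    chain : Chain G u rest
    ends  : last u rest ≡ v
    len   : length rest ≡ k

record Path {m} (G : Graph m) (u v : Fin m) : Set where
  field
    rest   : List (Fin m)
    chain  : Chain G u rest
    ends   : last u rest ≡ v
    unique : Unique (u ∷ rest)

vertices : ∀ {m} {G : Graph m} {u v} → Path G u v → List (Fin m)
vertices {u = u} p = u ∷ Path.rest p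

Connected : ∀ {m} → Graph m → Set
Connected {m} G = ∀ (u v : Fin m) → ∃ λ k → Walk G u v k

-- A cycle: distinct vertices v₀,…,v_k (k ≥ 2, i.e. at least 3 vertices),
-- consecutive ones adjacent, and v_k adjacent to v₀.
record Cycle {m} (G : Graph m) : Set where
  field
    start  : Fin m
    rest   : List (Fin m)
    long   : 2 ≤ length rest
    chain  : Chain G start rest
    closes : Adj G (last start rest) start
    unique : Unique (start ∷ rest)

Acyclic : ∀ {m} → Graph m → Set
Acyclic G = ¬ Cycle G

IsTree : ∀ {m} → Graph m → Set
IsTree G = Connected G × Acyclic G

IsDistance : ∀ {m} → Graph m → (Fin m → Fin m → ℕ) → Set
IsDistance {m} G d = ∀ (u v : Fin m) →
  Walk G u v (d u v) × (∀ k → Walk G u v k → d u v ≤ k)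

rep : ∀ {m n} → (Fin m → Fin m → ℕ) → (Fin n → Fin m) → Fin m → Vec ℤ n
rep d W u = tabulate (λ i → + d u (W i))

Resolving : ∀ {m n} → (Fin m → Fin m → ℕ) → (Fin n → Fin m) → Set
Resolving d W = Injective _≡_ _≡_ (rep d W)

Realizes : ∀ {m n} → Graph m → (Fin m → Fin m → ℕ) → (Fin n → Fin m)
         → (Vec ℤ n → Set) → Set
Realizes {m} {n} G d W S =
  Resolving d W × (∀ (x : Vec ℤ n) → (S x → ∃ λ u → rep d W u ≡ x)
                                   × (∀ u → rep d W u ≡ x → S x))

dec : ∀ {n} → Vec ℤ n → Vec ℤ n
dec x = map (λ a → a - 1ℤ) x

S₁ : ∀ {n} → (Vec ℤ n → Set) → Vec ℤ n → Set
S₁ S x = S x × S (dec x)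

S₀ : ∀ {n} → (Vec ℤ n → Set) → Vec ℤ n → Set
S₀ S x = S x × ¬ S (dec x)

OnWPath : ∀ {m n} → Graph m → (Fin n → Fin m) → Fin m → Set
OnWPath {m} G W u = ∃ λ i → ∃ λ j → Σ (Path G (W i) (W j)) λ p → u ∈ vertices p

-- A vector x ∈ S lies in S₁ exactly when the vertex u with r(u | W) = x has a vertex v with
-- d(v, w) = d(u, w) − 1 for every w ∈ W.  If u lies on a path of T between w, w′ ∈ W, that path
-- is the unique, hence shortest, one, so d(u, w) + d(u, w′) = d(w, w′) ≤ d(v, w) + d(v, w′),
-- which rules out such a v.  Conversely, if u ≠ W₀ let v be the neighbour of u towards W₀.  If
-- v is not one step closer to every landmark, some W_k has d(u, W_k) ≤ d(v, W_k), so a shortest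
-- path from u to W_k leaves u through another neighbour; in a tree two paths from u starting
-- differently meet nowhere else, so together they form a path from W_k to W₀ through u.

module Submission where

open import Defs hiding (sym)
open import Data.Nat using (ℕ; zero; suc; _+_; _≤_; _<_; z≤n; s≤s)
open import Data.Nat.Properties
  using ( ≤-refl; ≤-trans; ≤-antisym; ≤-pred; m≤n⇒m≤1+n; suc-injective; +-mono-≤; +-mono-<; n<1+n
        ; <⇒≱; ≤∧≢⇒<; module ≤-Reasoning)
import Data.Nat.Properties as ℕ
open import Data.Fin using (Fin; zero)
open import Data.Fin.Properties using (_≟_; ¬∀⟶∃¬)
open import Data.List using (List; []; _∷_; _++_; length; reverse; [_])
open import Data.List.Properties using (length-++; length-reverse; unfold-reverse; ++-assoc)
open import Data.List.Membership.Propositional using (_∈_; _∉_)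
open import Data.List.Membership.Propositional.Properties using (∈-++⁺ˡ; ∈-∃++)
open import Data.List.Relation.Unary.Any using (here; there)
import Data.List.Relation.Unary.Any.Properties as Any
open import Data.List.Relation.Unary.All as All using (All; []; _∷_)
import Data.List.Relation.Unary.All.Properties as All
open import Data.List.Relation.Unary.Unique.Propositional using (Unique; []; _∷_)
open import Data.List.Relation.Unary.Unique.Propositional.Properties using (Unique[x∷xs]⇒x∉xs)
import Data.List.Relation.Unary.Unique.Propositional.Properties as Unique
open import Data.List.Relation.Binary.Disjoint.Propositional using (Disjoint)
open import Data.List.Relation.Binary.Permutation.Setoid using (↭-sym)
open import Data.List.Relation.Binary.Permutation.Setoid.Properties using (Unique-resp-↭; ↭-reverse)
open import Data.Vec using (Vec; lookup)
import Data.Vec.Properties as Vec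
open import Data.Integer using (ℤ; +_; _-_; 1ℤ)
open import Data.Product using (Σ; ∃; ∃₂; _×_; _,_; proj₁; proj₂)
open import Data.Empty using (⊥-elim)
open import Relation.Nullary using (¬_; yes; no)
open import Relation.Binary.PropositionalEquality hiding ([_])
open import Function.Definitions using (Injective)

module _ {A : Set} where

  last-++ : ∀ (a : A) xs ys → last a (xs ++ ys) ≡ last (last a xs) ys
  last-++ a []       ys = refl
  last-++ a (x ∷ xs) ys = last-++ x xs ys

  last-∈ : ∀ (a : A) xs → last a xs ∈ a ∷ xs
  last-∈ a []       = here refl
  last-∈ a (x ∷ xs) = there (last-∈ x xs)

  reverseRest : A → List A → List A
  reverseRest a []       = []
  reverseRest a (b ∷ bs) = reverseRest b bs ++ [ a ]

  last-reverseRest : ∀ (a : A) xs → last (last a xs) (reverseRest a xs) ≡ a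
  last-reverseRest a []       = refl
  last-reverseRest a (b ∷ bs) = last-++ (last b bs) (reverseRest b bs) [ a ]

  last∷reverseRest : ∀ (a : A) xs → last a xs ∷ reverseRest a xs ≡ reverse (a ∷ xs)
  last∷reverseRest a []       = refl
  last∷reverseRest a (b ∷ bs) =
    trans (cong (_++ [ a ]) (last∷reverseRest b bs)) (sym (unfold-reverse a (b ∷ bs)))

  length-reverseRest : ∀ (a : A) xs → length (reverseRest a xs) ≡ length xs
  length-reverseRest a xs =
    suc-injective (trans (cong length (last∷reverseRest a xs)) (length-reverse (a ∷ xs)))

  unique-reverse : ∀ {xs : List A} → Unique xs → Unique (reverse xs)
  unique-reverse {xs} = Unique-resp-↭ (setoid A) (↭-sym (setoid A) (↭-reverse (setoid A) xs))

  unique-++⁻ˡ : ∀ (xs : List A) {ys} → Unique (xs ++ ys) → Unique xs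
  unique-++⁻ˡ []       _         = []
  unique-++⁻ˡ (x ∷ xs) (x∉ ∷ u) = All.++⁻ˡ xs x∉ ∷ unique-++⁻ˡ xs u

module _ {m : ℕ} (G : Graph m) where

  open import Data.List.Membership.DecPropositional (_≟_ {m}) using (_∈?_)

  chain-head : ∀ {a x xs} → Chain G a (x ∷ xs) → Adj G a x
  chain-head (step e _) = e

  chain-tail : ∀ {a x xs} → Chain G a (x ∷ xs) → Chain G x xs
  chain-tail (step _ c) = c

  chain-++⁺ : ∀ {a xs ys} → Chain G a xs → Chain G (last a xs) ys → Chain G a (xs ++ ys)
  chain-++⁺ stop       c′ = c′
  chain-++⁺ (step e c) c′ = step e (chain-++⁺ c c′)

  chain-++⁻ˡ : ∀ {a} xs {ys} → Chain G a (xs ++ ys) → Chain G a xs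
  chain-++⁻ˡ []       _          = stop
  chain-++⁻ˡ (x ∷ xs) (step e c) = step e (chain-++⁻ˡ xs c)

  chain-++⁻ʳ : ∀ {a} xs {ys} → Chain G a (xs ++ ys) → Chain G (last a xs) ys
  chain-++⁻ʳ []       c          = c
  chain-++⁻ʳ (x ∷ xs) (step _ c) = chain-++⁻ʳ xs c

  chain-reverse : ∀ {a xs} → Chain G a xs → Chain G (last a xs) (reverseRest a xs)
  chain-reverse stop = stop
  chain-reverse {a} (step {w = b} {vs = bs} e c) =
    chain-++⁺ (chain-reverse c)
      (subst (λ z → Chain G z [ a ]) (sym (last-reverseRest b bs)) (step (Graph.sym G e) stop))

  chain-back : ∀ {a z} pre {post} → Chain G a (pre ++ z ∷ post) → Chain G z (reverse pre ++ [ a ])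
  chain-back []        (step e _) = step (Graph.sym G e) stop
  chain-back {a} {z} (p ∷ pre) (step e c) =
    subst (Chain G z) (cong (_++ [ a ]) (sym (unfold-reverse p pre)))
      (chain-++⁺ (chain-back pre c)
        (subst (λ w → Chain G w [ a ]) (sym (last-++ z (reverse pre) [ p ])) (step (Graph.sym G e) stop)))

  chain-split : ∀ {a xs z} → Chain G a xs → z ∈ a ∷ xs →
                ∃₂ λ t s → Walk G a z t × Walk G z (last a xs) s × t + s ≡ length xs
  chain-split {xs = xs} c (here refl) =
    0 , length xs , record { rest = [] ; chain = stop ; ends = refl ; len = refl }
      , record { rest = xs ; chain = c ; ends = refl ; len = refl } , refl
  chain-split (step e c) (there z∈) with chain-split c z∈
  ... | t , s , w₁ , w₂ , t+s = suc t , s , walk-∷ e w₁ , w₂ , cong suc t+s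
    where
    walk-∷ : ∀ {a b c k} → Adj G a b → Walk G b c k → Walk G a c (suc k)
    walk-∷ e w = record { rest = _ ∷ Walk.rest w ; chain = step e (Walk.chain w)
                        ; ends = Walk.ends w ; len = cong suc (Walk.len w) }

  walk-edge : ∀ {a b} → Adj G a b → Walk G a b 1
  walk-edge e = record { rest = _ ∷ [] ; chain = step e stop ; ends = refl ; len = refl }

  walk-++ : ∀ {a b c k l} → Walk G a b k → Walk G b c l → Walk G a c (k + l)
  walk-++ {a} record { rest = xs ; chain = c₁ ; ends = refl ; len = refl }
              record { rest = ys ; chain = c₂ ; ends = refl ; len = refl } = record
    { rest = xs ++ ys ; chain = chain-++⁺ c₁ c₂ ; ends = last-++ a xs ys ; len = length-++ xs }

  walk-reverse : ∀ {a b k} → Walk G a b k → Walk G b a k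
  walk-reverse {a} record { rest = xs ; chain = c ; ends = refl ; len = refl } = record
    { rest = reverseRest a xs ; chain = chain-reverse c
    ; ends = last-reverseRest a xs ; len = length-reverseRest a xs }

  path-cons : ∀ {a b c} → Adj G a b → (p : Path G b c) → a ∉ vertices p → Path G a c
  path-cons e p a∉p = record { rest = vertices p ; chain = step e (Path.chain p) ; ends = Path.ends p
                             ; unique = All.¬Any⇒All¬ _ a∉p ∷ Path.unique p }

  path-suffix : ∀ {a b c} (p : Path G b c) → a ∈ vertices p →
                Σ (Path G a c) λ q → length (Path.rest q) ≤ length (Path.rest p)
  path-suffix p (here refl) = p , ≤-refl
  path-suffix record { rest = _ ∷ ws ; chain = step _ c ; ends = e ; unique = _ ∷ u } (there a∈) =
    let q , q≤ = path-suffix record { rest = ws ; chain = c ; ends = e ; unique = u } a∈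
    in  q , m≤n⇒m≤1+n q≤

  chain⇒path : ∀ {a xs} → Chain G a xs →
               Σ (Path G a (last a xs)) λ p → length (Path.rest p) ≤ length xs
  chain⇒path stop = record { rest = [] ; chain = stop ; ends = refl ; unique = [] ∷ [] } , z≤n
  chain⇒path {a} (step e c) with chain⇒path c
  ... | p , p≤ with a ∈? vertices p
  ...   | yes a∈p = let q , q≤ = path-suffix p a∈p in q , m≤n⇒m≤1+n (≤-trans q≤ p≤)
  ...   | no  a∉p = path-cons e p a∉p , s≤s p≤

  walk⇒path : ∀ {a b k} → Walk G a b k → Σ (Path G a b) λ p → length (Path.rest p) ≤ k
  walk⇒path record { chain = c ; ends = refl ; len = refl } = chain⇒path c

  path-join : ∀ {u b c} (p : Path G u b) (q : Path G u c) → Disjoint (Path.rest p) (Path.rest q) →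
              Σ (Path G b c) λ r → u ∈ vertices r
  path-join {u} record { rest = ys ; chain = cy ; ends = refl ; unique = uy }
                record { rest = zs ; chain = cz ; ends = refl ; unique = z∉ ∷ uz } ys∩zs =
    record { rest = reverseRest u ys ++ zs
           ; chain = chain-++⁺ (chain-reverse cy)
                       (subst (λ w → Chain G w zs) (sym (last-reverseRest u ys)) cz)
           ; ends = trans (last-++ (last u ys) (reverseRest u ys) zs)
                          (cong (λ w → last w zs) (last-reverseRest u ys))
           ; unique = Unique.++⁺ (subst Unique (sym (last∷reverseRest u ys)) (unique-reverse uy))
                                 uz disjoint }
    , ∈-++⁺ˡ (subst (u ∈_) (sym (last∷reverseRest u ys)) (Any.reverse⁺ {xs = u ∷ ys} (here refl)))
    where
    disjoint : Disjoint (last u ys ∷ reverseRest u ys) zs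
    disjoint {q} (q∈ , q∈zs)
      with Any.reverse⁻ {xs = u ∷ ys} (subst (q ∈_) (last∷reverseRest u ys) q∈)
    ... | here refl = All.lookup z∉ q∈zs refl
    ... | there q∈ys = ys∩zs (q∈ys , q∈zs)

  closed-chain⇒cycle : ∀ {a} xs → 2 ≤ length xs → Chain G a (xs ++ [ a ]) → Unique (a ∷ xs) →
                       Cycle G
  closed-chain⇒cycle {a} xs long c u = record
    { start = a ; rest = xs ; long = long ; chain = chain-++⁻ˡ xs c
    ; closes = chain-head (chain-++⁻ʳ xs c) ; unique = u }

  first-∈ : ∀ (X Y : List (Fin m)) {q} → q ∈ X → q ∈ Y →
            ∃ λ pre → ∃₂ λ z post → Y ≡ pre ++ z ∷ post × All (_∉ X) pre × z ∈ X
  first-∈ X (y ∷ Y) q∈X q∈Y with y ∈? X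
  ... | yes y∈X = [] , y , Y , refl , [] , y∈X
  ... | no  y∉X with q∈Y
  ...   | here refl = ⊥-elim (y∉X q∈X)
  ...   | there q∈Y′ with first-∈ X Y q∈X q∈Y′
  ...     | pre , z , post , refl , pre∉X , z∈X = y ∷ pre , z , post , refl , y∉X ∷ pre∉X , z∈X

  -- With z the first vertex of Y on X, the cycle runs from a along X up to z and back along Y.
  meeting-chains⇒cycle : ∀ {a x xs y ys q} → Chain G a (x ∷ xs) → Unique (a ∷ x ∷ xs) →
                         Chain G a (y ∷ ys) → Unique (a ∷ y ∷ ys) → x ≢ y →
                         q ∈ x ∷ xs → q ∈ y ∷ ys → Cycle G
  meeting-chains⇒cycle {a} {x} {xs} {y} {ys} cX uX cY uY x≢y q∈X q∈Y
    with first-∈ (x ∷ xs) (y ∷ ys) q∈X q∈Y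
  ... | pre , z , post , Y≡ , pre∉X , z∈X with ∈-∃++ z∈X
  ... | px , sx , X≡ =
    closed-chain⇒cycle (P ++ reverse pre) (long px pre X≡ Y≡)
      (subst (Chain G a) (sym (++-assoc P (reverse pre) [ a ]))
        (chain-++⁺ cP (subst (λ w → Chain G w (reverse pre ++ [ a ])) (sym (last-++ a px [ z ]))
                               (chain-back pre (subst (Chain G a) Y≡ cY)))))
      (Unique.++⁺ uP (unique-reverse (uniquePre (subst (λ Y → Unique (a ∷ Y)) Y≡ uY))) disjoint)
    where
    P : List (Fin m)
    P = px ++ [ z ]
    X≡P++sx : x ∷ xs ≡ P ++ sx
    X≡P++sx = trans X≡ (sym (++-assoc px [ z ] sx))
    cP : Chain G a P
    cP = chain-++⁻ˡ P (subst (Chain G a) X≡P++sx cX)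
    uP : Unique (a ∷ P)
    uP = unique-++⁻ˡ (a ∷ P) (subst (λ X → Unique (a ∷ X)) X≡P++sx uX)
    uniquePre : Unique (a ∷ pre ++ z ∷ post) → Unique pre
    uniquePre (_ ∷ u) = unique-++⁻ˡ pre u
    disjoint : Disjoint (a ∷ P) (reverse pre)
    disjoint (r∈aP , r∈rpre) with Any.reverse⁻ {xs = pre} r∈rpre | r∈aP
    ... | r∈pre | here refl =
      Unique[x∷xs]⇒x∉xs (subst (λ Y → Unique (a ∷ Y)) Y≡ uY) (∈-++⁺ˡ r∈pre)
    ... | r∈pre | there r∈P =
      All.lookup pre∉X r∈pre (subst (_ ∈_) (sym X≡P++sx) (∈-++⁺ˡ r∈P))
    long : ∀ px pre → x ∷ xs ≡ px ++ z ∷ sx → y ∷ ys ≡ pre ++ z ∷ post →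
           2 ≤ length ((px ++ [ z ]) ++ reverse pre)
    long (_ ∷ [])    _          _    _    = s≤s (s≤s z≤n)
    long (_ ∷ _ ∷ _) _          _    _    = s≤s (s≤s z≤n)
    long []          []         refl refl = ⊥-elim (x≢y refl)
    long []          (r ∷ pre′) _    _    =
      s≤s (subst (1 ≤_) (sym (length-reverse (r ∷ pre′))) (s≤s z≤n))

  module _ (acyclic : Acyclic G) where

    acyclic⇒diverging-disjoint : ∀ {a x xs y ys} → Chain G a (x ∷ xs) → Unique (a ∷ x ∷ xs) →
                                 Chain G a (y ∷ ys) → Unique (a ∷ y ∷ ys) → x ≢ y →
                                 Disjoint (x ∷ xs) (y ∷ ys)
    acyclic⇒diverging-disjoint cX uX cY uY x≢y (q∈X , q∈Y) =
      acyclic (meeting-chains⇒cycle cX uX cY uY x≢y q∈X q∈Y)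

    acyclic⇒chain-unique : ∀ {a xs ys} → Chain G a xs → Unique (a ∷ xs) →
                           Chain G a ys → Unique (a ∷ ys) →
                           last a xs ≡ last a ys → xs ≡ ys
    acyclic⇒chain-unique {xs = []} {[]} _ _ _ _ _ = refl
    acyclic⇒chain-unique {xs = []} {y ∷ ys} _ _ _ uY a≡ =
      ⊥-elim (Unique[x∷xs]⇒x∉xs uY (subst (_∈ y ∷ ys) (sym a≡) (last-∈ y ys)))
    acyclic⇒chain-unique {xs = x ∷ xs} {[]} _ uX _ _ ≡a =
      ⊥-elim (Unique[x∷xs]⇒x∉xs uX (subst (_∈ x ∷ xs) ≡a (last-∈ x xs)))
    acyclic⇒chain-unique {xs = x ∷ xs} {y ∷ ys} cX uX@(_ ∷ uX′) cY uY@(_ ∷ uY′) ends with x ≟ y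
    ... | yes refl = cong (x ∷_) (acyclic⇒chain-unique (chain-tail cX) uX′ (chain-tail cY) uY′ ends)
    ... | no  x≢y = ⊥-elim (acyclic⇒diverging-disjoint cX uX cY uY x≢y
                              (last-∈ x xs , subst (_∈ y ∷ ys) (sym ends) (last-∈ y ys)))

    acyclic⇒path-unique : ∀ {a b} (p q : Path G a b) → Path.rest p ≡ Path.rest q
    acyclic⇒path-unique p q =
      acyclic⇒chain-unique (Path.chain p) (Path.unique p) (Path.chain q) (Path.unique q)
                           (trans (Path.ends p) (sym (Path.ends q)))

module Distance {m : ℕ} (T : Graph m) (d : Fin m → Fin m → ℕ) (isDistance : IsDistance T d) where

  dist-walk : ∀ u v → Walk T u v (d u v)
  dist-walk u v = proj₁ (isDistance u v)

  dist-minimal : ∀ {u v k} → Walk T u v k → d u v ≤ k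
  dist-minimal {u} {v} {k} = proj₂ (isDistance u v) k

  dist-sym : ∀ u v → d u v ≡ d v u
  dist-sym u v = ≤-antisym (dist-minimal (walk-reverse T (dist-walk v u)))
                           (dist-minimal (walk-reverse T (dist-walk u v)))

  dist-triangle : ∀ a b c → d a c ≤ d a b + d b c
  dist-triangle a b c = dist-minimal (walk-++ T (dist-walk a b) (dist-walk b c))

  dist-edge : ∀ {a b} → Adj T a b → ∀ c → d a c ≤ suc (d b c)
  dist-edge e c = dist-minimal (walk-++ T (walk-edge T e) (dist-walk _ c))

  geodesic : ∀ a b → Σ (Path T a b) λ p → length (Path.rest p) ≤ d a b
  geodesic a b = walk⇒path T (dist-walk a b)

  geodesic-next : ∀ {a b w ws} → Chain T a (w ∷ ws) → last w ws ≡ b → length (w ∷ ws) ≤ d a b →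
                  d w b < d a b
  geodesic-next {ws = ws} c ends len≤ =
    ≤-trans (s≤s (dist-minimal tail)) len≤
    where
    tail : Walk T _ _ (length ws)
    tail = record { rest = ws ; chain = chain-tail T c ; ends = ends ; len = refl }

  module _ (acyclic : Acyclic T) where

    path-length≤dist : ∀ {a b} (p : Path T a b) → length (Path.rest p) ≤ d a b
    path-length≤dist {a} {b} p =
      let q , q≤ = geodesic a b
      in  subst (λ xs → length xs ≤ d a b) (acyclic⇒path-unique T acyclic q p) q≤

    path-dist-sum : ∀ {a b u} (p : Path T a b) → u ∈ vertices p → ∀ v → d u a + d u b ≤ d v a + d v b
    path-dist-sum {a} {b} {u} p u∈p v with chain-split T (Path.chain p) u∈p
    ... | t , s , w₁ , w₂ , t+s≡ = begin
      d u a + d u b         ≤⟨ +-mono-≤ (dist-minimal (walk-reverse T w₁))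
                                        (dist-minimal (subst (λ c → Walk T u c s) (Path.ends p) w₂)) ⟩
      t + s                 ≡⟨ t+s≡ ⟩
      length (Path.rest p)  ≤⟨ path-length≤dist p ⟩
      d a b                 ≤⟨ dist-triangle a v b ⟩
      d a v + d v b         ≡⟨ cong (_+ d v b) (dist-sym a v) ⟩
      d v a + d v b         ∎
      where open ≤-Reasoning

StepCloser : ∀ {m n} → (Fin m → Fin m → ℕ) → (Fin n → Fin m) → Fin m → Fin m → Set
StepCloser d W v u = ∀ k → suc (d v (W k)) ≡ d u (W k)

module Landmarks {m : ℕ} (T : Graph m) (d : Fin m → Fin m → ℕ) (isDistance : IsDistance T d)
                 (acyclic : Acyclic T) where

  open Distance T d isDistance

  onWPath⇒¬stepCloser : ∀ {n} {W : Fin n → Fin m} {u} → OnWPath T W u → ∀ v → ¬ StepCloser d W v u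
  onWPath⇒¬stepCloser {W = W} (i , j , p , u∈p) v closer =
    <⇒≱ (+-mono-< (n<1+n _) (n<1+n _))
        (subst₂ (λ a b → a + b ≤ d v (W i) + d v (W j)) (sym (closer i)) (sym (closer j))
                (path-dist-sum acyclic p u∈p v))

  ¬stepCloser⇒onWPath : ∀ {n} (W : Fin n → Fin m) u → (∀ v → ¬ StepCloser d W v u) → OnWPath T W u
  ¬stepCloser⇒onWPath {zero} W u none = ⊥-elim (none u λ ())
  ¬stepCloser⇒onWPath {suc n} W u none with u ≟ W zero
  ... | yes refl =
    zero , zero , record { rest = [] ; chain = stop ; ends = refl ; unique = [] ∷ [] } , here refl
  ... | no u≢W₀ = branch (proj₁ (geodesic u (W zero)))
    where
    branch : Path T u (W zero) → OnWPath T W u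
    branch record { rest = [] ; ends = u≡W₀ } = ⊥-elim (u≢W₀ u≡W₀)
    branch p@record { rest = v ∷ zs ; chain = c ; unique = uq }
      with ¬∀⟶∃¬ (suc n) _ (λ k → suc (d v (W k)) ℕ.≟ d u (W k)) (none v)
    ... | k , ¬closer with geodesic u (W k)
    ... | q , q≤ = k , zero , path-join T q p (disjoint q q≤)
      where
      farther : d u (W k) ≤ d v (W k)
      farther = ≤-pred (≤∧≢⇒< (dist-edge (chain-head T c) (W k)) (λ eq → ¬closer (sym eq)))
      disjoint : (q : Path T u (W k)) → length (Path.rest q) ≤ d u (W k) → Disjoint (Path.rest q) (v ∷ zs)
      disjoint record { rest = [] } _ (() , _)
      disjoint record { rest = w ∷ ws ; chain = c′ ; ends = e ; unique = uq′ } len≤ =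
        acyclic⇒diverging-disjoint T acyclic c′ uq′ c uq w≢v
        where
        w≢v : w ≢ v
        w≢v refl = <⇒≱ (geodesic-next c′ e len≤) farther

+m≡+n-1⇒1+m≡n : ∀ {a b} → + a ≡ + b - 1ℤ → suc a ≡ b
+m≡+n-1⇒1+m≡n {b = zero}  ()
+m≡+n-1⇒1+m≡n {b = suc b} refl = refl

module _ {m n : ℕ} (d : Fin m → Fin m → ℕ) (W : Fin n → Fin m) {u v : Fin m} where

  rep-dec⇒stepCloser : rep d W v ≡ dec (rep d W u) → StepCloser d W v u
  rep-dec⇒stepCloser eq k = +m≡+n-1⇒1+m≡n (begin
    + d v (W k)                 ≡⟨ Vec.lookup∘tabulate _ k ⟨
    lookup (rep d W v) k        ≡⟨ cong (λ x → lookup x k) eq ⟩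
    lookup (dec (rep d W u)) k  ≡⟨ Vec.lookup-map k _ (rep d W u) ⟩
    lookup (rep d W u) k - 1ℤ   ≡⟨ cong (_- 1ℤ) (Vec.lookup∘tabulate _ k) ⟩
    + d u (W k) - 1ℤ            ∎)
    where open ≡-Reasoning

  stepCloser⇒rep-dec : StepCloser d W v u → rep d W v ≡ dec (rep d W u)
  stepCloser⇒rep-dec closer =
    trans (Vec.tabulate-cong (λ k → cong (λ a → + a - 1ℤ) (closer k))) (Vec.tabulate-∘ _ _)

lemma4p1 : ∀ {m n} (T : Graph m) (d : Fin m → Fin m → ℕ) (W : Fin n → Fin m)
    (S : Vec ℤ n → Set) →
    IsTree T → IsDistance T d → Injective _≡_ _≡_ W → Realizes T d W S →
    ∀ (x : Vec ℤ n) →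
    (S₀ S x → ∃ λ u → rep d W u ≡ x × OnWPath T W u)
    × ((∃ λ u → rep d W u ≡ x × OnWPath T W u) → S₀ S x)
lemma4p1 T d W S (_ , acyclic) isDistance _ (_ , realizes) x = S₀⇒onWPath , onWPath⇒S₀
  where
  open Landmarks T d isDistance acyclic
  realized : ∀ {y} → S y → ∃ λ u → rep d W u ≡ y
  realized {y} = proj₁ (realizes y)
  represented : ∀ {y} u → rep d W u ≡ y → S y
  represented {y} = proj₂ (realizes y)
  S₀⇒onWPath : S₀ S x → ∃ λ u → rep d W u ≡ x × OnWPath T W u
  S₀⇒onWPath (Sx , ¬Sdx) =
    let u , u↦x = realized Sx in
    u , u↦x , ¬stepCloser⇒onWPath W u λ v closer →
      ¬Sdx (represented v (trans (stepCloser⇒rep-dec d W closer) (cong dec u↦x)))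
  onWPath⇒S₀ : (∃ λ u → rep d W u ≡ x × OnWPath T W u) → S₀ S x
  onWPath⇒S₀ (u , u↦x , onPath) =
    represented u u↦x , λ Sdx →
      let v , v↦ = realized Sdx in
      onWPath⇒¬stepCloser onPath v (rep-dec⇒stepCloser d W (trans v↦ (cong dec (sym u↦x))))
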